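{- Let $e,e'$ be distinct edges of a hypergraph $H=(V,E)$ and let $k$ be a number. (1) If $\gamma_H(e)\ge k$ and $\gamma_H(e')<k$, then $\gamma_{H'}(e)=\gamma_H(e)$ where $H'=H\setminus e'$ is obtained by deleting $e'$. (2) If $\gamma_H(e)<k$ and $\gamma_H(e')\ge k$, let $H'=H/e'$ be obtained by contracting $e'$ and let $f$ be the edge of $H'$ corresponding to $e$. Then $\gamma_H(e)=\gamma_{H'}(f)$.
   Context: A hypergraph $H=(V,E)$ has finite vertex set $V$ and a (multi)set $E$ of edges, each a nonempty subset of $V$. For $U\subseteq V$, $H[U]=(U,\{e\in E:e\subseteq U\})$. For $A\subseteq V$, $\delta_H(A)=\{e\in E: e\cap A\ne\emptyset,\ e\cap (V\setminus A)\ne\emptyset\}$. $\lambda(H)=\min_{\emptyset\subsetneq A\subsetneq V}|\delta_H(A)|$ and the strength of $e$ is $\gamma_H(e)=\max_{e\subseteq U\subseteq V}\lambda(H[U])$. Contracting an edge $e'$ yields $H/e'$: all vertices of $e'$ are identified into a single new vertex $v_{e'}$, every edge contained in $e'$ is removed, and every edge $g$ properly intersecting $e'$ has $g\cap e'$ replaced by $v_{e'}$ (this is the corresponding edge of $g$). -}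

module Defs where

open import Data.Bool using (Bool; true; false; _∧_; _∨_; not; if_then_else_)
open import Data.Nat using (ℕ; zero; suc; _≤_; _<_) renaming (_⊔_ to _⊔ℕ_; _⊓_ to _⊓ℕ_)
open import Data.Fin using (Fin)
open import Data.Fin.Subset using (Subset; _∩_; _∪_; _─_; ⁅_⁆; _∈_; _⊆_; Nonempty)
open import Data.List using (List; []; _∷_; map; _++_; foldr; filter; length; lookup)
open import Data.List.Relation.Unary.All using (All)
open import Data.Vec using (Vec; []; _∷_)
open import Data.Unit using (⊤)
open import Data.Empty using (⊥)
open import Data.Product using (_×_)

-- ℕ ∪ {∞}  (edge-connectivity of a one-vertex hypergraph is ∞)
data ℕ∞ : Set where
  fin : ℕ → ℕ∞
  ∞   : ℕ∞

_⊓∞_ : ℕ∞ → ℕ∞ → ℕ∞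
fin a ⊓∞ fin b = fin (a ⊓ℕ b)
fin a ⊓∞ ∞     = fin a
∞     ⊓∞ y     = y

_⊔∞_ : ℕ∞ → ℕ∞ → ℕ∞
fin a ⊔∞ fin b = fin (a ⊔ℕ b)
fin a ⊔∞ ∞     = ∞
∞     ⊔∞ y     = ∞

_≤∞_ : ℕ → ℕ∞ → Set
k ≤∞ fin x = k ≤ x
k ≤∞ ∞     = ⊤

_<∞_ : ℕ∞ → ℕ → Set
fin x <∞ k = x < k
∞     <∞ k = ⊥

isEmpty : ∀ {n} → Subset n → Bool
isEmpty []      = true
isEmpty (b ∷ s) = not b ∧ isEmpty s

nonEmpty : ∀ {n} → Subset n → Bool
nonEmpty s = not (isEmpty s)

sub : ∀ {n} → Subset n → Subset n → Bool
sub []      []      = true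
sub (a ∷ s) (b ∷ t) = (not a ∨ b) ∧ sub s t

allSubsets : ∀ n → List (Subset n)
allSubsets zero    = [] ∷ []
allSubsets (suc n) = map (false ∷_) (allSubsets n) ++ map (true ∷_) (allSubsets n)

count : {A : Set} → (A → Bool) → List A → ℕ
count p []       = 0
count p (x ∷ xs) = if p x then suc (count p xs) else count p xs

-- A hypergraph on vertex set V ⊆ Fin n with a multiset (list) of edges.
-- Well-formedness: every edge is nonempty and contained in V.
WellFormed : ∀ {n} → Subset n → List (Subset n) → Set
WellFormed V es = All (λ e → Nonempty e × e ⊆ V) es

cutSize : ∀ {n} → List (Subset n) → Subset n → Subset n → ℕ
cutSize es U A = count (λ e → sub e U ∧ nonEmpty (e ∩ A) ∧ nonEmpty (e ∩ (U ─ A))) es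

edgeConn : ∀ {n} → List (Subset n) → Subset n → ℕ∞
edgeConn {n} es U =
  foldr (λ A r → if sub A U ∧ nonEmpty A ∧ nonEmpty (U ─ A)
                 then fin (cutSize es U A) ⊓∞ r else r)
        ∞ (allSubsets n)

strength : ∀ {n} → Subset n → List (Subset n) → Subset n → ℕ∞
strength {n} V es S =
  foldr (λ U r → if sub S U ∧ sub U V then edgeConn es U ⊔∞ r else r)
        (fin 0) (allSubsets n)

deleteEdge : ∀ {n} (es : List (Subset n)) → Fin (length es) → List (Subset n)
deleteEdge = Data.List.removeAt

-- Contraction of edge e' ; the new vertex v_{e'} is represented by a
-- chosen vertex r ∈ e' (vertices of e' ∖ {r} are removed).
contractV : ∀ {n} → Subset n → Subset n → Fin n → Subset n
contractV V e' r = (V ─ e') ∪ ⁅ r ⁆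

contractEdge : ∀ {n} → Subset n → Fin n → Subset n → Subset n
contractEdge e' r g = if nonEmpty (g ∩ e') then (g ─ e') ∪ ⁅ r ⁆ else g

contractEs : ∀ {n} → List (Subset n) → Subset n → Fin n → List (Subset n)
contractEs es e' r = map (contractEdge e' r) (filter (λ g → Data.Bool._≟_ (sub g e') false) es)

-- Deleting e′: a vertex set U attaining γ(e) cannot contain e′, since otherwise
-- γ(e′) ≥ λ(H[U]) = γ(e) ≥ k; so H[U] and (H ∖ e′)[U] have the same cuts, while
-- deleting an edge can only lower edge-connectivities.
--
-- Contracting e′ to r ∈ e′: a vertex set Z′ of H/e′ corresponds to its preimage pre Z′
-- in H, and the cuts of (H/e′)[Z′] are exactly the cuts of H[pre Z′] that do not split e′,
-- with the same sizes. Fix W ⊇ e′ with λ(H[W]) = γ(e′) ≥ k. For U meeting W, a cut of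
-- H[U ∪ W] either cuts W or restricts to a cut of H[U] that does not split W. Gluing W to
-- a set attaining γ(e) therefore gives γ(e) ≤ γ_{H/e′}(f), and gluing W to pre Z′ gives
-- min (k, λ((H/e′)[Z′])) ≤ γ(e) < k, hence γ_{H/e′}(f) ≤ γ(e).

module Submission where

open import Defs
open import Level using (0ℓ)
open import Data.Bool using (Bool; true; false; _∧_; if_then_else_; _≟_)
open import Data.Bool.Properties using (⇔→≡; ¬-not)
open import Data.Empty using (⊥; ⊥-elim)
open import Data.Unit using (⊤; tt)
open import Data.Nat using (ℕ; suc; _≤_; z≤n; s≤s)
import Data.Nat.Properties as ℕ
open import Data.Fin using (Fin; zero; suc)
open import Data.Fin.Subset using (Subset; _∩_; _∪_; _─_; ⁅_⁆; _∈_; _∉_; _⊆_; Nonempty)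
open import Data.Fin.Subset.Properties
  using ( _∈?_; nonempty?; drop-there; drop-∷-⊆; ⊆-antisym; x∈⁅x⁆; x∈⁅y⁆⇒x≡y
        ; p∩q⊆q; p⊆p∪q; q⊆p∪q; x∈p∩q⁺; x∈p∩q⁻; x∈p∪q⁺; x∈p∪q⁻; x∈p∧x∉q⇒x∈p─q )
open import Data.List using (List; []; _∷_; map; foldr; filter; length; lookup; removeAt)
import Data.List.Membership.Propositional as List
open import Data.List.Membership.Propositional.Properties using (∈-map⁺; ∈-++⁺ˡ; ∈-++⁺ʳ; ∈-lookup)
import Data.List.Relation.Unary.All as All
import Data.List.Relation.Unary.Any as Any
open import Data.Vec using ([]; _∷_; here; there; tabulate)
import Data.Vec as Vec
open import Data.Vec.Properties using (lookup∘tabulate; []=⇒lookup; lookup⇒[]=)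
open import Data.Product using (_×_; _,_; proj₁; proj₂; ∃-syntax)
open import Data.Product.Function.NonDependent.Propositional using (_×-⇔_)
open import Data.Sum using (_⊎_; inj₁; inj₂; [_,_]′)
open import Function using (_∘_)
open import Function.Bundles using (_⇔_; mk⇔; Equivalence)
import Function.Properties.Equivalence as ⇔
open import Relation.Nullary using (¬_; Dec; does; yes; no)
open import Relation.Unary using (Pred; Decidable)
open import Relation.Binary.PropositionalEquality using (_≡_; _≢_; refl; sym; trans; cong; subst)

open Equivalence using (to; from)

infix 4 _≼_

_≼_ : ℕ∞ → ℕ∞ → Set
fin a ≼ fin b = a ≤ b
_     ≼ ∞     = ⊤
∞     ≼ fin _ = ⊥

≼-refl : ∀ x → x ≼ x
≼-refl (fin a) = ℕ.≤-refl
≼-refl ∞       = tt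

≼-trans : ∀ {x y z} → x ≼ y → y ≼ z → x ≼ z
≼-trans {fin _} {fin _} {fin _} p q = ℕ.≤-trans p q
≼-trans {fin _} {_}     {∞}     _ _ = tt
≼-trans {∞}     {∞}     {∞}     _ _ = tt
≼-trans {fin _} {∞}     {fin _} _ ()
≼-trans {∞}     {fin _} {_}     () _
≼-trans {∞}     {∞}     {fin _} _ ()

≼-antisym : ∀ {x y} → x ≼ y → y ≼ x → x ≡ y
≼-antisym {fin _} {fin _} p q = cong fin (ℕ.≤-antisym p q)
≼-antisym {∞}     {∞}     _ _ = refl
≼-antisym {fin _} {∞}     _ ()
≼-antisym {∞}     {fin _} () _

0≼ : ∀ x → fin 0 ≼ x
0≼ (fin _) = z≤n
0≼ ∞       = tt

x⊓∞y≼x : ∀ x y → x ⊓∞ y ≼ x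
x⊓∞y≼x (fin a) (fin b) = ℕ.m⊓n≤m a b
x⊓∞y≼x (fin a) ∞       = ℕ.≤-refl
x⊓∞y≼x ∞       (fin _) = tt
x⊓∞y≼x ∞       ∞       = tt

x⊓∞y≼y : ∀ x y → x ⊓∞ y ≼ y
x⊓∞y≼y (fin a) (fin b) = ℕ.m⊓n≤n a b
x⊓∞y≼y (fin _) ∞       = tt
x⊓∞y≼y ∞       y       = ≼-refl y

⊓∞-glb : ∀ {x y z} → z ≼ x → z ≼ y → z ≼ x ⊓∞ y
⊓∞-glb {fin _} {fin _} {fin _} p q = ℕ.⊓-glb p q
⊓∞-glb {fin _} {∞}     {fin _} p _ = p
⊓∞-glb {∞}     {_}     {_}     _ q = q
⊓∞-glb {fin _} {_}     {∞}     () _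

x≼x⊔∞y : ∀ x y → x ≼ x ⊔∞ y
x≼x⊔∞y (fin a) (fin b) = ℕ.m≤m⊔n a b
x≼x⊔∞y (fin _) ∞       = tt
x≼x⊔∞y ∞       _       = tt

y≼x⊔∞y : ∀ x y → y ≼ x ⊔∞ y
y≼x⊔∞y (fin a) (fin b) = ℕ.m≤n⊔m a b
y≼x⊔∞y (fin _) ∞       = tt
y≼x⊔∞y ∞       (fin _) = tt
y≼x⊔∞y ∞       ∞       = tt

⊔∞-lub : ∀ {x y z} → x ≼ z → y ≼ z → x ⊔∞ y ≼ z
⊔∞-lub {fin _} {fin _} {fin _} p q = ℕ.⊔-lub p q
⊔∞-lub {fin _} {fin _} {∞}     _ _ = tt
⊔∞-lub {fin _} {∞}     {_}     _ q = q
⊔∞-lub {∞}     {_}     {_}     p _ = p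

⊔∞-sel : ∀ x y → x ⊔∞ y ≡ x ⊎ x ⊔∞ y ≡ y
⊔∞-sel (fin a) (fin b) with ℕ.⊔-sel a b
... | inj₁ eq = inj₁ (cong fin eq)
... | inj₂ eq = inj₂ (cong fin eq)
⊔∞-sel (fin _) ∞ = inj₂ refl
⊔∞-sel ∞       _ = inj₁ refl

≤∞⇒≼ : ∀ {k} x → k ≤∞ x → fin k ≼ x
≤∞⇒≼ (fin _) p = p
≤∞⇒≼ ∞       _ = tt

<∞⇒⋠ : ∀ {k} x → x <∞ k → ¬ (fin k ≼ x)
<∞⇒⋠ (fin _) = ℕ.<⇒≱

<∞-≼-trans : ∀ {k} x y → x <∞ k → fin k ≼ y → x ≼ y
<∞-≼-trans (fin _) (fin _) p q = ℕ.≤-trans (ℕ.<⇒≤ p) q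
<∞-≼-trans (fin _) ∞       _ _ = tt

k⊓∞m≼x⇒m≼x : ∀ {k} m x → fin k ⊓∞ m ≼ x → x <∞ k → m ≼ x
k⊓∞m≼x⇒m≼x {k} (fin a) (fin _) p q with ℕ.⊓-sel k a
... | inj₁ eq = ⊥-elim (ℕ.<⇒≱ q (subst (_≤ _) eq p))
... | inj₂ eq = subst (_≤ _) eq p
k⊓∞m≼x⇒m≼x ∞ (fin _) p q = ⊥-elim (ℕ.<⇒≱ q p)

module _ {A : Set} (c : A → Bool) (g : A → ℕ∞) where

  minOver : List A → ℕ∞
  minOver = foldr (λ a r → if c a then g a ⊓∞ r else r) ∞

  maxOver : List A → ℕ∞
  maxOver = foldr (λ a r → if c a then g a ⊔∞ r else r) (fin 0)

  minOver-≼ : ∀ {a} xs → a List.∈ xs → c a ≡ true → minOver xs ≼ g a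
  minOver-≼ (x ∷ xs) (Any.here refl) ca rewrite ca = x⊓∞y≼x (g x) (minOver xs)
  minOver-≼ (x ∷ xs) (Any.there a∈xs) ca with c x
  ... | true  = ≼-trans (x⊓∞y≼y (g x) (minOver xs)) (minOver-≼ xs a∈xs ca)
  ... | false = minOver-≼ xs a∈xs ca

  ≼-minOver : ∀ z xs → (∀ a → c a ≡ true → z ≼ g a) → z ≼ minOver xs
  ≼-minOver (fin _) [] _ = tt
  ≼-minOver ∞       [] _ = tt
  ≼-minOver z (x ∷ xs) h with c x in cx
  ... | true  = ⊓∞-glb (h x cx) (≼-minOver z xs h)
  ... | false = ≼-minOver z xs h

  ≼-maxOver : ∀ {a} xs → a List.∈ xs → c a ≡ true → g a ≼ maxOver xs
  ≼-maxOver (x ∷ xs) (Any.here refl) ca rewrite ca = x≼x⊔∞y (g x) (maxOver xs)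
  ≼-maxOver (x ∷ xs) (Any.there a∈xs) ca with c x
  ... | true  = ≼-trans (≼-maxOver xs a∈xs ca) (y≼x⊔∞y (g x) (maxOver xs))
  ... | false = ≼-maxOver xs a∈xs ca

  maxOver-≼ : ∀ z xs → (∀ a → c a ≡ true → g a ≼ z) → maxOver xs ≼ z
  maxOver-≼ z [] _ = 0≼ z
  maxOver-≼ z (x ∷ xs) h with c x in cx
  ... | true  = ⊔∞-lub (h x cx) (maxOver-≼ z xs h)
  ... | false = maxOver-≼ z xs h

  maxOver-attained : ∀ xs → maxOver xs ≡ fin 0 ⊎ ∃[ a ] (c a ≡ true × maxOver xs ≡ g a)
  maxOver-attained [] = inj₁ refl
  maxOver-attained (x ∷ xs) with c x in cx
  ... | false = maxOver-attained xs
  ... | true with ⊔∞-sel (g x) (maxOver xs) | maxOver-attained xs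
  ...   | inj₁ eq | _                    = inj₂ (x , cx , eq)
  ...   | inj₂ eq | inj₁ eq₀             = inj₁ (trans eq eq₀)
  ...   | inj₂ eq | inj₂ (a , ca , eqₐ) = inj₂ (a , ca , trans eq eqₐ)

∈-allSubsets : ∀ {n} (s : Subset n) → s List.∈ allSubsets n
∈-allSubsets []          = Any.here refl
∈-allSubsets (false ∷ s) = ∈-++⁺ˡ (∈-map⁺ (false ∷_) (∈-allSubsets s))
∈-allSubsets (true ∷ s)  = ∈-++⁺ʳ _ (∈-map⁺ (true ∷_) (∈-allSubsets s))

x∈p─q⁻ : ∀ {n} {x : Fin n} (p q : Subset n) → x ∈ p ─ q → x ∈ p × x ∉ q
x∈p─q⁻ (true  ∷ _) (false ∷ _) here = here , λ ()
x∈p─q⁻ {x = zero} (false ∷ _) (false ∷ _) ()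
x∈p─q⁻ {x = zero} (_     ∷ _) (true  ∷ _) ()
x∈p─q⁻ (_ ∷ p) (_ ∷ q) (there x∈p─q) with x∈p─q⁻ p q x∈p─q
... | x∈p , x∉q = there x∈p , x∉q ∘ drop-there

∧≡true⇔ : ∀ {a b} → a ∧ b ≡ true ⇔ (a ≡ true × b ≡ true)
∧≡true⇔ {true}  {true} = mk⇔ (λ _ → refl , refl) (λ _ → refl)
∧≡true⇔ {true}  {false} = mk⇔ (λ ()) (λ ())
∧≡true⇔ {false} = mk⇔ (λ ()) (λ ())

sub⇔⊆ : ∀ {n} {s t : Subset n} → sub s t ≡ true ⇔ s ⊆ t
sub⇔⊆ = mk⇔ sub⁻ sub⁺
  where
  sub⁻ : ∀ {n} {s t : Subset n} → sub s t ≡ true → s ⊆ t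
  sub⁻ {s = true  ∷ _} {true  ∷ _} _ here         = here
  sub⁻ {s = true  ∷ _} {true  ∷ _} h (there x∈s) = there (sub⁻ h x∈s)
  sub⁻ {s = true  ∷ _} {false ∷ _} ()
  sub⁻ {s = false ∷ _} {_     ∷ _} h (there x∈s) = there (sub⁻ h x∈s)

  sub⁺ : ∀ {n} {s t : Subset n} → s ⊆ t → sub s t ≡ true
  sub⁺ {s = []}        {[]}    _ = refl
  sub⁺ {s = false ∷ _} {_ ∷ _} h = sub⁺ (drop-∷-⊆ h)
  sub⁺ {s = true  ∷ _} {_ ∷ _} h with h here
  ... | here = sub⁺ (drop-∷-⊆ h)

nonEmpty⇔Nonempty : ∀ {n} {s : Subset n} → nonEmpty s ≡ true ⇔ Nonempty s
nonEmpty⇔Nonempty = mk⇔ nonEmpty⁻ nonEmpty⁺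
  where
  nonEmpty⁻ : ∀ {n} {s : Subset n} → nonEmpty s ≡ true → Nonempty s
  nonEmpty⁻ {s = true  ∷ _} _ = zero , here
  nonEmpty⁻ {s = false ∷ _} h with nonEmpty⁻ h
  ... | x , x∈s = suc x , there x∈s

  nonEmpty⁺ : ∀ {n} {s : Subset n} → Nonempty s → nonEmpty s ≡ true
  nonEmpty⁺ {s = true  ∷ _} _                  = refl
  nonEmpty⁺ {s = false ∷ _} (suc x , there x∈s) = nonEmpty⁺ (x , x∈s)

nonEmpty≡false⇒Empty : ∀ {n} {s : Subset n} → nonEmpty s ≡ false → ¬ Nonempty s
nonEmpty≡false⇒Empty eq ne with () ← trans (sym eq) (from nonEmpty⇔Nonempty ne)

∧-⇔ : ∀ {a b} {P Q : Set} → a ≡ true ⇔ P → b ≡ true ⇔ Q → a ∧ b ≡ true ⇔ (P × Q)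
∧-⇔ p q = ⇔.trans ∧≡true⇔ (p ×-⇔ q)

-- Cuts

module _ {n : ℕ} where

  IsCut : Subset n → Subset n → Set
  IsCut U A = A ⊆ U × Nonempty A × Nonempty (U ─ A)

  isCutᵇ : Subset n → Subset n → Bool
  isCutᵇ U A = sub A U ∧ nonEmpty A ∧ nonEmpty (U ─ A)

  isCutᵇ⇔IsCut : ∀ U A → isCutᵇ U A ≡ true ⇔ IsCut U A
  isCutᵇ⇔IsCut _ _ = ∧-⇔ sub⇔⊆ (∧-⇔ nonEmpty⇔Nonempty nonEmpty⇔Nonempty)

  Crosses : Subset n → Subset n → Subset n → Set
  Crosses U A g = g ⊆ U × Nonempty (g ∩ A) × Nonempty (g ∩ (U ─ A))

  crossesᵇ : Subset n → Subset n → Subset n → Bool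
  crossesᵇ U A g = sub g U ∧ nonEmpty (g ∩ A) ∧ nonEmpty (g ∩ (U ─ A))

  crossesᵇ⇔Crosses : ∀ U A g → crossesᵇ U A g ≡ true ⇔ Crosses U A g
  crossesᵇ⇔Crosses _ _ _ = ∧-⇔ sub⇔⊆ (∧-⇔ nonEmpty⇔Nonempty nonEmpty⇔Nonempty)

  Unsplit : Subset n → Subset n → Set
  Unsplit W A = (∀ {x} → x ∈ W → x ∉ A) ⊎ W ⊆ A

  unsplit⊎isCut : ∀ W A → Unsplit W A ⊎ IsCut W (A ∩ W)
  unsplit⊎isCut W A with nonempty? (A ∩ W) | nonempty? (W ─ A)
  ... | no ∄A∩W | _ = inj₁ (inj₁ λ x∈W x∈A → ∄A∩W (_ , x∈p∩q⁺ (x∈A , x∈W)))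
  ... | yes _   | no ∄W─A = inj₁ (inj₂ W⊆A)
    where
    W⊆A : W ⊆ A
    W⊆A {x} x∈W with x ∈? A
    ... | yes x∈A = x∈A
    ... | no  x∉A = ⊥-elim (∄W─A (x , x∈p∧x∉q⇒x∈p─q x∈W x∉A))
  ... | yes a   | yes (y , y∈W─A) =
    let y∈W , y∉A = x∈p─q⁻ W A y∈W─A
    in inj₂ (p∩q⊆q A W , a , y , x∈p∧x∉q⇒x∈p─q y∈W (y∉A ∘ proj₁ ∘ x∈p∩q⁻ A W))

  unsplit⇒isCut : ∀ {U W A c} → c ∈ U → c ∈ W →
                  IsCut (U ∪ W) A → Unsplit W A → IsCut U (A ∩ U)
  unsplit⇒isCut {U} {W} {A} {c} c∈U c∈W (A⊆U∪W , (a , a∈A) , (b , b∈U∪W─A)) unsplit =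
    p∩q⊆q A U , inner unsplit , outer unsplit
    where
    b∈U∪W = proj₁ (x∈p─q⁻ (U ∪ W) A b∈U∪W─A)
    b∉A   = proj₂ (x∈p─q⁻ (U ∪ W) A b∈U∪W─A)

    inner : Unsplit W A → Nonempty (A ∩ U)
    inner (inj₂ W⊆A) = c , x∈p∩q⁺ (W⊆A c∈W , c∈U)
    inner (inj₁ W∌A) with x∈p∪q⁻ U W (A⊆U∪W a∈A)
    ... | inj₁ a∈U = a , x∈p∩q⁺ (a∈A , a∈U)
    ... | inj₂ a∈W = ⊥-elim (W∌A a∈W a∈A)

    outer : Unsplit W A → Nonempty (U ─ A ∩ U)
    outer (inj₁ W∌A) = c , x∈p∧x∉q⇒x∈p─q c∈U (W∌A c∈W ∘ proj₁ ∘ x∈p∩q⁻ A U)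
    outer (inj₂ W⊆A) with x∈p∪q⁻ U W b∈U∪W
    ... | inj₁ b∈U = b , x∈p∧x∉q⇒x∈p─q b∈U (b∉A ∘ proj₁ ∘ x∈p∩q⁻ A U)
    ... | inj₂ b∈W = ⊥-elim (b∉A (W⊆A b∈W))

  unsplit-∩ : ∀ {T W A Z} → T ⊆ W → T ⊆ Z → Unsplit W A → Unsplit T (A ∩ Z)
  unsplit-∩ {A = A} {Z} T⊆W T⊆Z (inj₁ W∌A) =
    inj₁ λ x∈T x∈A∩Z → W∌A (T⊆W x∈T) (proj₁ (x∈p∩q⁻ A Z x∈A∩Z))
  unsplit-∩ T⊆W T⊆Z (inj₂ W⊆A) = inj₂ λ x∈T → x∈p∩q⁺ (W⊆A (T⊆W x∈T) , T⊆Z x∈T)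

  ∪-lub : ∀ {U W V : Subset n} → U ⊆ V → W ⊆ V → U ∪ W ⊆ V
  ∪-lub {U} {W} U⊆V W⊆V x∈U∪W = [ U⊆V , W⊆V ]′ (x∈p∪q⁻ U W x∈U∪W)

module _ {A : Set} where

  count-mono : ∀ (p q : A → Bool) xs → (∀ x → p x ≡ true → q x ≡ true) →
               count p xs ≤ count q xs
  count-mono p q []       _ = z≤n
  count-mono p q (x ∷ xs) h with p x in px | q x in qx
  ... | true  | true  = s≤s (count-mono p q xs h)
  ... | false | true  = ℕ.m≤n⇒m≤1+n (count-mono p q xs h)
  ... | false | false = count-mono p q xs h
  ... | true  | false with () ← trans (sym (h x px)) qx

  count-cong : ∀ (p q : A → Bool) xs → (∀ x → p x ≡ q x) → count p xs ≡ count q xs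
  count-cong p q []       _ = refl
  count-cong p q (x ∷ xs) h rewrite h x with q x
  ... | true  = cong suc (count-cong p q xs h)
  ... | false = count-cong p q xs h

  count-map : ∀ {B : Set} (p : B → Bool) (f : A → B) xs →
              count p (map f xs) ≡ count (p ∘ f) xs
  count-map p f []       = refl
  count-map p f (x ∷ xs) with p (f x)
  ... | true  = cong suc (count-map p f xs)
  ... | false = count-map p f xs

  count-filter : ∀ {P : Pred A 0ℓ} (P? : Decidable P) (p : A → Bool) xs →
                 count p (filter P? xs) ≡ count (λ x → does (P? x) ∧ p x) xs
  count-filter P? p []       = refl
  count-filter P? p (x ∷ xs) with does (P? x)
  ... | false = count-filter P? p xs
  ... | true with p x
  ...   | true  = cong suc (count-filter P? p xs)
  ...   | false = count-filter P? p xs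

  count-removeAt-≤ : ∀ (p : A → Bool) xs j → count p (removeAt xs j) ≤ count p xs
  count-removeAt-≤ p (x ∷ xs) zero with p x
  ... | true  = ℕ.n≤1+n _
  ... | false = ℕ.≤-refl
  count-removeAt-≤ p (x ∷ xs) (suc j) with p x
  ... | true  = s≤s (count-removeAt-≤ p xs j)
  ... | false = count-removeAt-≤ p xs j

  count-removeAt : ∀ (p : A → Bool) xs j → p (lookup xs j) ≡ false →
                   count p (removeAt xs j) ≡ count p xs
  count-removeAt p (x ∷ xs) zero    px rewrite px = refl
  count-removeAt p (x ∷ xs) (suc j) h with p x
  ... | true  = cong suc (count-removeAt p xs j h)
  ... | false = count-removeAt p xs j h

module _ {n : ℕ} (es : List (Subset n)) where

  cutSize-mono : ∀ {U A Y B} → (∀ {g} → Crosses U A g → Crosses Y B g) →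
                 cutSize es U A ≤ cutSize es Y B
  cutSize-mono {U} {A} {Y} {B} f =
    count-mono (crossesᵇ U A) (crossesᵇ Y B) es
               λ g h → from (crossesᵇ⇔Crosses Y B g) (f (to (crossesᵇ⇔Crosses U A g) h))

  edgeConn≼cutSize : ∀ {U A} → IsCut U A → edgeConn es U ≼ fin (cutSize es U A)
  edgeConn≼cutSize {U} {A} cut =
    minOver-≼ (isCutᵇ U) (λ A → fin (cutSize es U A)) (allSubsets n) (∈-allSubsets A)
              (from (isCutᵇ⇔IsCut U A) cut)

  ≼-edgeConn : ∀ {U} x → (∀ {A} → IsCut U A → x ≼ fin (cutSize es U A)) → x ≼ edgeConn es U
  ≼-edgeConn {U} x h =
    ≼-minOver (isCutᵇ U) (λ A → fin (cutSize es U A)) x (allSubsets n)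
              λ A c → h (to (isCutᵇ⇔IsCut U A) c)

  module _ (V S : Subset n) where

    private
      candidate : Subset n → Bool
      candidate U = sub S U ∧ sub U V

      candidate⇔ : ∀ {U} → candidate U ≡ true ⇔ (S ⊆ U × U ⊆ V)
      candidate⇔ = ∧-⇔ sub⇔⊆ sub⇔⊆

    edgeConn≼strength : ∀ {U} → S ⊆ U → U ⊆ V → edgeConn es U ≼ strength V es S
    edgeConn≼strength {U} S⊆U U⊆V =
      ≼-maxOver candidate (edgeConn es) (allSubsets n) (∈-allSubsets U)
                (from candidate⇔ (S⊆U , U⊆V))

    strength-≼ : ∀ x → (∀ {U} → S ⊆ U → U ⊆ V → edgeConn es U ≼ x) → strength V es S ≼ x
    strength-≼ x h =
      maxOver-≼ candidate (edgeConn es) x (allSubsets n)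
                λ U c → let S⊆U , U⊆V = to candidate⇔ c in h S⊆U U⊆V

    strength-attained : strength V es S ≡ fin 0 ⊎
                        ∃[ U ] (S ⊆ U × U ⊆ V × strength V es S ≡ edgeConn es U)
    strength-attained with maxOver-attained candidate (edgeConn es) (allSubsets n)
    ... | inj₁ eq           = inj₁ eq
    ... | inj₂ (U , c , eq) = let S⊆U , U⊆V = to candidate⇔ c in inj₂ (U , S⊆U , U⊆V , eq)

  cutSize-∩-≤ : ∀ {U Y} A → U ⊆ Y → cutSize es U (A ∩ U) ≤ cutSize es Y A
  cutSize-∩-≤ {U} {Y} A U⊆Y = cutSize-mono widen
    where
    widen : ∀ {g} → Crosses U (A ∩ U) g → Crosses Y A g
    widen {g} (g⊆U , (x , x∈g∩A∩U) , (y , y∈g∩U─A∩U)) =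
      let x∈g , x∈A∩U = x∈p∩q⁻ g (A ∩ U) x∈g∩A∩U
          y∈g , y∈U─A∩U = x∈p∩q⁻ g (U ─ A ∩ U) y∈g∩U─A∩U
          y∈U , y∉A∩U = x∈p─q⁻ U (A ∩ U) y∈U─A∩U
      in (λ z∈g → U⊆Y (g⊆U z∈g))
       , (x , x∈p∩q⁺ (x∈g , proj₁ (x∈p∩q⁻ A U x∈A∩U)))
       , (y , x∈p∩q⁺ (y∈g , x∈p∧x∉q⇒x∈p─q (U⊆Y y∈U) λ y∈A → y∉A∩U (x∈p∩q⁺ (y∈A , y∈U))))

  -- A cut of U ∪ W either cuts W or, leaving W on one side, restricts to a cut of U.
  edgeConn-∪ : ∀ {U W c} x → c ∈ U → c ∈ W → x ≼ edgeConn es W →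
               (∀ {A} → IsCut U (A ∩ U) → Unsplit W A → x ≼ fin (cutSize es U (A ∩ U))) →
               x ≼ edgeConn es (U ∪ W)
  edgeConn-∪ {U} {W} x c∈U c∈W x≼λW h = ≼-edgeConn x bound
    where
    bound : ∀ {A} → IsCut (U ∪ W) A → x ≼ fin (cutSize es (U ∪ W) A)
    bound {A} cut with unsplit⊎isCut W A
    ... | inj₁ unsplit =
      ≼-trans (h (unsplit⇒isCut c∈U c∈W cut unsplit) unsplit) (cutSize-∩-≤ A (p⊆p∪q W))
    ... | inj₂ cutW =
      ≼-trans x≼λW (≼-trans (edgeConn≼cutSize cutW) (cutSize-∩-≤ A (q⊆p∪q U W)))

-- Deleting an edge

module _ {n : ℕ} (es : List (Subset n)) (j : Fin (length es)) where

  private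
    es′ = removeAt es j
    e′  = lookup es j

  edgeConn-removeAt-≼ : ∀ U → edgeConn es′ U ≼ edgeConn es U
  edgeConn-removeAt-≼ U = ≼-edgeConn es (edgeConn es′ U) λ {A} cut →
    ≼-trans (edgeConn≼cutSize es′ cut) (count-removeAt-≤ (crossesᵇ U A) es j)

  edgeConn-removeAt : ∀ {U} → ¬ (e′ ⊆ U) → edgeConn es′ U ≡ edgeConn es U
  edgeConn-removeAt {U} e′⊈U = ≼-antisym (edgeConn-removeAt-≼ U) (≼-edgeConn es′ (edgeConn es U) bound)
    where
    bound : ∀ {A} → IsCut U A → edgeConn es U ≼ fin (cutSize es′ U A)
    bound {A} cut = ≼-trans (edgeConn≼cutSize es cut) (ℕ.≤-reflexive (sym (count-removeAt _ es j e′-stays)))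
      where
      e′-stays : crossesᵇ U A e′ ≡ false
      e′-stays = ¬-not λ crosses → e′⊈U (proj₁ (to (crossesᵇ⇔Crosses U A e′) crosses))

  strength-removeAt : ∀ V S {k} → k ≤∞ strength V es S → strength V es e′ <∞ k →
                      strength V es′ S ≡ strength V es S
  strength-removeAt V S {k} k≤γS γe′<k = ≼-antisym
    (strength-≼ es′ V S _ λ S⊆U U⊆V →
      ≼-trans (edgeConn-removeAt-≼ _) (edgeConn≼strength es V S S⊆U U⊆V))
    lower
    where
    lower : strength V es S ≼ strength V es′ S
    lower with strength-attained es V S
    ... | inj₁ γS≡0 = subst (_≼ strength V es′ S) (sym γS≡0) (0≼ _)
    ... | inj₂ (U , S⊆U , U⊆V , γS≡λU) =
      subst (_≼ strength V es′ S) (sym γS≡λU)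
        (subst (_≼ strength V es′ S) (edgeConn-removeAt e′⊈U) (edgeConn≼strength es′ V S S⊆U U⊆V))
      where
      e′⊈U : ¬ (e′ ⊆ U)
      e′⊈U e′⊆U = <∞⇒⋠ (strength V es e′) γe′<k
        (≼-trans (subst (fin k ≼_) γS≡λU (≤∞⇒≼ _ k≤γS)) (edgeConn≼strength es V e′ e′⊆U U⊆V))

-- Contracting a vertex set

-- π identifies the vertices of e′ with r; a vertex set T of H/e′ corresponds to pre T in H.
module Contraction {n : ℕ} (e′ : Subset n) (r : Fin n) (r∈e′ : r ∈ e′) where

  π : Fin n → Fin n
  π x with x ∈? e′
  ... | yes _ = r
  ... | no  _ = x

  π-∈ : ∀ {x} → x ∈ e′ → π x ≡ r
  π-∈ {x} x∈e′ with x ∈? e′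
  ... | yes _    = refl
  ... | no  x∉e′ = ⊥-elim (x∉e′ x∈e′)

  π-∉ : ∀ {x} → x ∉ e′ → π x ≡ x
  π-∉ {x} x∉e′ with x ∈? e′
  ... | yes x∈e′ = ⊥-elim (x∉e′ x∈e′)
  ... | no  _    = refl

  pre : Subset n → Subset n
  pre T = tabulate (λ x → Vec.lookup T (π x))

  ∈pre⇔ : ∀ T {x} → x ∈ pre T ⇔ π x ∈ T
  ∈pre⇔ T {x} = mk⇔
    (λ x∈preT → lookup⇒[]= (π x) T (trans (sym (lookup∘tabulate _ x)) ([]=⇒lookup x∈preT)))
    (λ πx∈T → lookup⇒[]= x (pre T) (trans (lookup∘tabulate _ x) ([]=⇒lookup πx∈T)))

  pre-mono : ∀ {Z T} → Z ⊆ T → pre Z ⊆ pre T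
  pre-mono {Z} {T} Z⊆T x∈preZ = from (∈pre⇔ T) (Z⊆T (to (∈pre⇔ Z) x∈preZ))

  contract : Subset n → Subset n
  contract = contractEdge e′ r

  ∈contract⁺ : ∀ {g x} → x ∈ g → π x ∈ contract g
  ∈contract⁺ {g} {x} x∈g with nonEmpty (g ∩ e′) in meets | x ∈? e′
  ... | true  | yes _    = x∈p∪q⁺ (inj₂ (x∈⁅x⁆ r))
  ... | true  | no  x∉e′ = x∈p∪q⁺ (inj₁ (x∈p∧x∉q⇒x∈p─q x∈g x∉e′))
  ... | false | yes x∈e′ = ⊥-elim (nonEmpty≡false⇒Empty meets (x , x∈p∩q⁺ (x∈g , x∈e′)))
  ... | false | no  _    = x∈g

  ∈contract⁻ : ∀ {g y} → y ∈ contract g → ∃[ x ] (x ∈ g × π x ≡ y)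
  ∈contract⁻ {g} {y} y∈cg with nonEmpty (g ∩ e′) in meets
  ... | true with x∈p∪q⁻ (g ─ e′) ⁅ r ⁆ y∈cg
  ...   | inj₁ y∈g─e′ = let y∈g , y∉e′ = x∈p─q⁻ g e′ y∈g─e′ in y , y∈g , π-∉ y∉e′
  ...   | inj₂ y∈⁅r⁆ =
    let x , x∈g∩e′ = to nonEmpty⇔Nonempty meets
        x∈g , x∈e′ = x∈p∩q⁻ g e′ x∈g∩e′
    in x , x∈g , trans (π-∈ x∈e′) (sym (x∈⁅y⁆⇒x≡y r y∈⁅r⁆))
  ∈contract⁻ {g} {y} y∈g | false =
    y , y∈g , π-∉ λ y∈e′ → nonEmpty≡false⇒Empty meets (y , x∈p∩q⁺ (y∈g , y∈e′))

  contract-⊆⇔ : ∀ {g T} → contract g ⊆ T ⇔ g ⊆ pre T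
  contract-⊆⇔ {g} {T} = mk⇔
    (λ cg⊆T {x} x∈g → from (∈pre⇔ T) (cg⊆T (∈contract⁺ x∈g)))
    (λ g⊆preT {y} y∈cg → let x , x∈g , πx≡y = ∈contract⁻ y∈cg in
                     subst (_∈ T) πx≡y (to (∈pre⇔ T) (g⊆preT x∈g)))

  contract-meets⇔ : ∀ {g T} → Nonempty (contract g ∩ T) ⇔ Nonempty (g ∩ pre T)
  contract-meets⇔ {g} {T} = mk⇔
    (λ (y , y∈cg∩T) →
      let y∈cg , y∈T = x∈p∩q⁻ (contract g) T y∈cg∩T
          x , x∈g , πx≡y = ∈contract⁻ y∈cg
      in x , x∈p∩q⁺ (x∈g , from (∈pre⇔ T) (subst (_∈ T) (sym πx≡y) y∈T)))
    (λ (x , x∈g∩preT) →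
      let x∈g , x∈preT = x∈p∩q⁻ g (pre T) x∈g∩preT
      in π x , x∈p∩q⁺ (∈contract⁺ x∈g , to (∈pre⇔ T) x∈preT))

  pre-─ : ∀ Z A → pre (Z ─ A) ≡ pre Z ─ pre A
  pre-─ Z A = ⊆-antisym
    (λ x∈pre[Z─A] → let πx∈Z , πx∉A = x∈p─q⁻ Z A (to (∈pre⇔ (Z ─ A)) x∈pre[Z─A]) in
       x∈p∧x∉q⇒x∈p─q (from (∈pre⇔ Z) πx∈Z) (πx∉A ∘ to (∈pre⇔ A)))
    (λ x∈preZ─preA → let x∈preZ , x∉preA = x∈p─q⁻ (pre Z) (pre A) x∈preZ─preA in
       from (∈pre⇔ (Z ─ A)) (x∈p∧x∉q⇒x∈p─q (to (∈pre⇔ Z) x∈preZ) (x∉preA ∘ from (∈pre⇔ A))))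

  crosses-contract⇔ : ∀ Z A g → Crosses Z A (contract g) ⇔ Crosses (pre Z) (pre A) g
  crosses-contract⇔ Z A g =
    contract-⊆⇔ ×-⇔ contract-meets⇔ ×-⇔
    subst (λ T → Nonempty (contract g ∩ (Z ─ A)) ⇔ Nonempty (g ∩ T)) (pre-─ Z A) contract-meets⇔

  ¬crosses-inside : ∀ Z A {g} → g ⊆ e′ → ¬ Crosses (pre Z) (pre A) g
  ¬crosses-inside Z A {g} g⊆e′ (_ , (x , x∈g∩preA) , (y , y∈g∩preZ─preA)) =
    let x∈g , x∈preA = x∈p∩q⁻ g (pre A) x∈g∩preA
        y∈g , y∈preZ─preA = x∈p∩q⁻ g (pre Z ─ pre A) y∈g∩preZ─preA
        y∉preA = proj₂ (x∈p─q⁻ (pre Z) (pre A) y∈preZ─preA)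
        r∈A = subst (_∈ A) (π-∈ (g⊆e′ x∈g)) (to (∈pre⇔ A) x∈preA)
    in y∉preA (from (∈pre⇔ A) (subst (_∈ A) (sym (π-∈ (g⊆e′ y∈g))) r∈A))

  cutSize-contract : ∀ es Z A → cutSize (contractEs es e′ r) Z A ≡ cutSize es (pre Z) (pre A)
  cutSize-contract es Z A =
    trans (count-map (crossesᵇ Z A) contract (filter outside? es))
      (trans (count-filter outside? (crossesᵇ Z A ∘ contract) es)
        (count-cong _ (crossesᵇ (pre Z) (pre A)) es pointwise))
    where
    outside? : ∀ g → _
    outside? g = sub g e′ ≟ false

    pointwise : ∀ g → does (outside? g) ∧ crossesᵇ Z A (contract g) ≡ crossesᵇ (pre Z) (pre A) g
    pointwise g with sub g e′ in g⊆?e′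
    ... | false = ⇔→≡ (⇔.trans (crossesᵇ⇔Crosses Z A (contract g))
                       (⇔.trans (crosses-contract⇔ Z A g) (⇔.sym (crossesᵇ⇔Crosses (pre Z) (pre A) g))))
    ... | true  = sym (¬-not λ crosses →
                    ¬crosses-inside Z A (to sub⇔⊆ g⊆?e′) (to (crossesᵇ⇔Crosses (pre Z) (pre A) g) crosses))

  Fixed : Subset n → Set
  Fixed Z = ∀ {x} → x ∈ Z → π x ≡ x

  isCut-pre : ∀ {Z A} → Fixed Z → IsCut Z A → IsCut (pre Z) (pre A)
  isCut-pre {Z} {A} fixed (A⊆Z , (a , a∈A) , (b , b∈Z─A)) =
    let b∈Z , b∉A = x∈p─q⁻ Z A b∈Z─A in
      (λ x∈preA → from (∈pre⇔ Z) (A⊆Z (to (∈pre⇔ A) x∈preA)))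
    , (a , from (∈pre⇔ A) (subst (_∈ A) (sym (fixed (A⊆Z a∈A))) a∈A))
    , (b , x∈p∧x∉q⇒x∈p─q (from (∈pre⇔ Z) (subst (_∈ Z) (sym (fixed b∈Z)) b∈Z))
                          λ b∈preA → b∉A (subst (_∈ A) (fixed b∈Z) (to (∈pre⇔ A) b∈preA)))

  isCut-unpre : ∀ {Z B} → B ⊆ Z → IsCut (pre Z) (pre B) → IsCut Z B
  isCut-unpre {Z} {B} B⊆Z (_ , (a , a∈preB) , (b , b∈preZ─preB)) =
    let b∈preZ , b∉preB = x∈p─q⁻ (pre Z) (pre B) b∈preZ─preB in
      B⊆Z
    , (π a , to (∈pre⇔ B) a∈preB)
    , (π b , x∈p∧x∉q⇒x∈p─q (to (∈pre⇔ Z) b∈preZ) (b∉preB ∘ from (∈pre⇔ B)))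

  π-unsplit : ∀ {A} x → Unsplit e′ A → π x ∈ A ⇔ x ∈ A
  π-unsplit x unsplit with x ∈? e′ | unsplit
  ... | yes x∈e′ | inj₁ e′∌A = mk⇔ (⊥-elim ∘ e′∌A r∈e′) (⊥-elim ∘ e′∌A x∈e′)
  ... | yes x∈e′ | inj₂ e′⊆A = mk⇔ (λ _ → e′⊆A x∈e′) (λ _ → e′⊆A r∈e′)
  ... | no  _    | _         = ⇔.refl

  pre-∩-unsplit : ∀ {A Z} → A ⊆ pre Z → Unsplit e′ A → pre (A ∩ Z) ≡ A
  pre-∩-unsplit {A} {Z} A⊆preZ unsplit = ⊆-antisym
    (λ {x} x∈pre[A∩Z] → to (π-unsplit x unsplit) (proj₁ (x∈p∩q⁻ A Z (to (∈pre⇔ (A ∩ Z)) x∈pre[A∩Z]))))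
    (λ {x} x∈A → from (∈pre⇔ (A ∩ Z))
                   (x∈p∩q⁺ (from (π-unsplit x unsplit) x∈A , to (∈pre⇔ Z) (A⊆preZ x∈A))))

  module _ (es : List (Subset n)) where

    private
      es′ = contractEs es e′ r

    edgeConn-pre-≼ : ∀ {Z} → Fixed Z → edgeConn es (pre Z) ≼ edgeConn es′ Z
    edgeConn-pre-≼ {Z} fixed = ≼-edgeConn es′ (edgeConn es (pre Z)) λ {A} cut →
      ≼-trans (edgeConn≼cutSize es (isCut-pre fixed cut))
              (ℕ.≤-reflexive (sym (cutSize-contract es Z A)))

    edgeConn-contract-≼ : ∀ {Z A} → IsCut (pre Z) A → Unsplit e′ A →
                          edgeConn es′ Z ≼ fin (cutSize es (pre Z) A)
    edgeConn-contract-≼ {Z} {A} cut unsplit =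
      ≼-trans (edgeConn≼cutSize es′ (isCut-unpre (p∩q⊆q A Z) (subst (IsCut (pre Z)) (sym pre[A∩Z]≡A) cut)))
              (ℕ.≤-reflexive (trans (cutSize-contract es Z (A ∩ Z)) (cong (cutSize es (pre Z)) pre[A∩Z]≡A)))
      where
      pre[A∩Z]≡A : pre (A ∩ Z) ≡ A
      pre[A∩Z]≡A = pre-∩-unsplit (proj₁ cut) unsplit

  module _ (V : Subset n) (e′⊆V : e′ ⊆ V) where

    fixed-contractV : ∀ {Z} → Z ⊆ contractV V e′ r → Fixed Z
    fixed-contractV Z⊆V′ x∈Z with x∈p∪q⁻ (V ─ e′) ⁅ r ⁆ (Z⊆V′ x∈Z)
    ... | inj₁ x∈V─e′ = π-∉ (proj₂ (x∈p─q⁻ V e′ x∈V─e′))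
    ... | inj₂ x∈⁅r⁆ rewrite x∈⁅y⁆⇒x≡y r x∈⁅r⁆ = π-∈ r∈e′

    ⊆-pre-contractV : V ⊆ pre (contractV V e′ r)
    ⊆-pre-contractV {x} x∈V = from (∈pre⇔ (contractV V e′ r)) (π[x]∈V′ (x ∈? e′))
      where
      π[x]∈V′ : Dec (x ∈ e′) → π x ∈ contractV V e′ r
      π[x]∈V′ (yes x∈e′) rewrite π-∈ x∈e′ = x∈p∪q⁺ (inj₂ (x∈⁅x⁆ r))
      π[x]∈V′ (no  x∉e′) rewrite π-∉ x∉e′ = x∈p∪q⁺ (inj₁ (x∈p∧x∉q⇒x∈p─q x∈V x∉e′))

    pre-contractV-⊆ : pre (contractV V e′ r) ⊆ V
    pre-contractV-⊆ {x} x∈preV′ = x∈V (x ∈? e′)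
      where
      x∈V : Dec (x ∈ e′) → x ∈ V
      x∈V (yes x∈e′) = e′⊆V x∈e′
      x∈V (no  x∉e′) with x∈p∪q⁻ (V ─ e′) ⁅ r ⁆
                            (subst (_∈ contractV V e′ r) (π-∉ x∉e′) (to (∈pre⇔ (contractV V e′ r)) x∈preV′))
      ... | inj₁ x∈V─e′ = proj₁ (x∈p─q⁻ V e′ x∈V─e′)
      ... | inj₂ x∈⁅r⁆  = ⊥-elim (x∉e′ (subst (_∈ e′) (sym (x∈⁅y⁆⇒x≡y r x∈⁅r⁆)) r∈e′))

    module _ (es : List (Subset n)) {W k} (e′⊆W : e′ ⊆ W) (W⊆V : W ⊆ V)
             (k≼λW : fin k ≼ edgeConn es W) (S : Subset n) where

      private
        V′  = contractV V e′ r
        es′ = contractEs es e′ r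
        γ   = strength V es S
        γ′  = strength V′ es′ (contract S)

      edgeConn≼strength-contract : ∀ {Z} → S ⊆ Z → Z ⊆ V → Unsplit e′ Z → edgeConn es Z ≼ γ′
      edgeConn≼strength-contract {Z} S⊆Z Z⊆V unsplit =
        ≼-trans (subst (λ T → edgeConn es T ≼ edgeConn es′ (Z ∩ V′)) pre[Z∩V′]≡Z
                       (edgeConn-pre-≼ es (fixed-contractV (p∩q⊆q Z V′))))
                (edgeConn≼strength es′ V′ (contract S)
                   (from contract-⊆⇔ (subst (S ⊆_) (sym pre[Z∩V′]≡Z) S⊆Z)) (p∩q⊆q Z V′))
        where
        pre[Z∩V′]≡Z : pre (Z ∩ V′) ≡ Z
        pre[Z∩V′]≡Z = pre-∩-unsplit (⊆-pre-contractV ∘ Z⊆V) unsplit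

      strength≼strength-contract : γ <∞ k → γ ≼ γ′
      strength≼strength-contract γ<k with strength-attained es V S
      ... | inj₁ γ≡0 = subst (_≼ γ′) (sym γ≡0) (0≼ γ′)
      ... | inj₂ (U , S⊆U , U⊆V , γ≡λU) with nonempty? (U ∩ e′)
      ...   | no ∄U∩e′ = subst (_≼ γ′) (sym γ≡λU)
          (edgeConn≼strength-contract S⊆U U⊆V (inj₁ λ x∈e′ x∈U → ∄U∩e′ (_ , x∈p∩q⁺ (x∈U , x∈e′))))
      ...   | yes (c , c∈U∩e′) = subst (_≼ γ′) (sym γ≡λU) (≼-trans λU≼λ[U∪W] λ[U∪W]≼γ′)
        where
        c∈U = proj₁ (x∈p∩q⁻ U e′ c∈U∩e′)
        c∈e′ = proj₂ (x∈p∩q⁻ U e′ c∈U∩e′)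

        λU≼λW : edgeConn es U ≼ edgeConn es W
        λU≼λW = <∞-≼-trans (edgeConn es U) (edgeConn es W) (subst (_<∞ k) γ≡λU γ<k) k≼λW

        λU≼λ[U∪W] : edgeConn es U ≼ edgeConn es (U ∪ W)
        λU≼λ[U∪W] = edgeConn-∪ es (edgeConn es U) c∈U (e′⊆W c∈e′) λU≼λW λ cut _ → edgeConn≼cutSize es cut

        λ[U∪W]≼γ′ : edgeConn es (U ∪ W) ≼ γ′
        λ[U∪W]≼γ′ = edgeConn≼strength-contract (p⊆p∪q W ∘ S⊆U) (∪-lub U⊆V W⊆V) (inj₂ (q⊆p∪q U W ∘ e′⊆W))

      edgeConn-contract≼strength : γ <∞ k → ∀ {Z′} → contract S ⊆ Z′ → Z′ ⊆ V′ → edgeConn es′ Z′ ≼ γ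
      edgeConn-contract≼strength γ<k {Z′} f⊆Z′ Z′⊆V′ = bound (r ∈? Z′)
        where
        Z = pre Z′
        S⊆Z : S ⊆ Z
        S⊆Z = to contract-⊆⇔ f⊆Z′
        Z⊆V : Z ⊆ V
        Z⊆V = pre-contractV-⊆ ∘ pre-mono Z′⊆V′

        bound : Dec (r ∈ Z′) → edgeConn es′ Z′ ≼ γ
        bound (no r∉Z′) =
          ≼-trans (≼-edgeConn es (edgeConn es′ Z′) λ cut → edgeConn-contract-≼ es cut (inj₁ (e′∌A cut)))
                  (edgeConn≼strength es V S S⊆Z Z⊆V)
          where
          e′∌A : ∀ {A} → IsCut Z A → ∀ {x} → x ∈ e′ → x ∉ A
          e′∌A (A⊆Z , _) x∈e′ x∈A = r∉Z′ (subst (_∈ Z′) (π-∈ x∈e′) (to (∈pre⇔ Z′) (A⊆Z x∈A)))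
        bound (yes r∈Z′) = k⊓∞m≼x⇒m≼x λ′ γ (≼-trans k⊓λ′≼λW⊓λ′ (≼-trans λW⊓λ′≼λ[Z∪W] λ[Z∪W]≼γ)) γ<k
          where
          λ′ = edgeConn es′ Z′

          e′⊆Z : e′ ⊆ Z
          e′⊆Z x∈e′ = from (∈pre⇔ Z′) (subst (_∈ Z′) (sym (π-∈ x∈e′)) r∈Z′)

          k⊓λ′≼λW⊓λ′ : fin k ⊓∞ λ′ ≼ edgeConn es W ⊓∞ λ′
          k⊓λ′≼λW⊓λ′ = ⊓∞-glb (≼-trans (x⊓∞y≼x (fin k) λ′) k≼λW) (x⊓∞y≼y (fin k) λ′)

          λW⊓λ′≼λ[Z∪W] : edgeConn es W ⊓∞ λ′ ≼ edgeConn es (Z ∪ W)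
          λW⊓λ′≼λ[Z∪W] = edgeConn-∪ es _ (e′⊆Z r∈e′) (e′⊆W r∈e′) (x⊓∞y≼x _ λ′) λ cut unsplit →
            ≼-trans (x⊓∞y≼y (edgeConn es W) λ′) (edgeConn-contract-≼ es cut (unsplit-∩ e′⊆W e′⊆Z unsplit))

          λ[Z∪W]≼γ : edgeConn es (Z ∪ W) ≼ γ
          λ[Z∪W]≼γ = edgeConn≼strength es V S (p⊆p∪q W ∘ S⊆Z) (∪-lub Z⊆V W⊆V)

      strength-contract : γ <∞ k → γ ≡ γ′
      strength-contract γ<k = ≼-antisym (strength≼strength-contract γ<k)
        (strength-≼ es′ V′ (contract S) γ (edgeConn-contract≼strength γ<k))

strength-contractEs : ∀ {n} (V : Subset n) es {e′ r k} S → e′ ⊆ V → r ∈ e′ →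
  strength V es S <∞ k → k ≤∞ strength V es e′ →
  strength V es S ≡ strength (contractV V e′ r) (contractEs es e′ r) (contractEdge e′ r S)
strength-contractEs V es {e′} {r} {k} S e′⊆V r∈e′ γS<k k≤γe′ with strength-attained es V e′
... | inj₁ γe′≡0 =
  ⊥-elim (<∞⇒⋠ _ γS<k (≼-trans (subst (fin k ≼_) γe′≡0 (≤∞⇒≼ _ k≤γe′)) (0≼ _)))
... | inj₂ (W , e′⊆W , W⊆V , γe′≡λW) =
  Contraction.strength-contract e′ r r∈e′ V e′⊆V es e′⊆W W⊆V
    (subst (fin k ≼_) γe′≡λW (≤∞⇒≼ _ k≤γe′)) S γS<k

lemma6 : ∀ {n} (V : Subset n) (es : List (Subset n)) → WellFormed V es →
    (i j : Fin (length es)) → i ≢ j → (k : ℕ) →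
    (k ≤∞ strength V es (lookup es i) → strength V es (lookup es j) <∞ k →
      strength V (deleteEdge es j) (lookup es i) ≡ strength V es (lookup es i))
    ×
    ((r : Fin n) → r ∈ lookup es j →
      strength V es (lookup es i) <∞ k → k ≤∞ strength V es (lookup es j) →
      strength V es (lookup es i)
        ≡ strength (contractV V (lookup es j) r) (contractEs es (lookup es j) r)
                   (contractEdge (lookup es j) r (lookup es i)))
lemma6 V es wf i j _ k =
    strength-removeAt es j V (lookup es i)
  , λ r r∈e′ → strength-contractEs V es (lookup es i) e′⊆V r∈e′
  where
  e′⊆V : lookup es j ⊆ V
  e′⊆V = proj₂ (All.lookup wf (∈-lookup j))
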